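{- Let $n,m\ge3$ be odd integers and let $S$ and $T$ be 2-partitions of $\mathbb{Z}_n^*$ and $\mathbb{Z}_m^*$ respectively, and let $W_{ST}$ be any product of $S$ and $T$. Then $W_{ST}$ is skew if and only if both $S$ and $T$ are skew.
   Context: $\mathbb{Z}_k^*=\mathbb{Z}_k\setminus\{0\}$; a 2-partition of $\mathbb{Z}_k^*$ ($k$ odd) is a partition into unordered pairs $\{x_i,y_i\}$. It is skew if $\{\pm(x_i+y_i)\bmod k\}=\mathbb{Z}_k^*$. Product: let $n=2q+1$, $m=2p+1$. Let $\tilde S$ be any set of ordered pairs obtained by ordering each pair of $S$ in either way. Let $\bar T=\{(r_j,t_j)\}_{j=1}^p$ be obtained by ordering each pair of $T$ so that $\bigcup_j\{\pm r_j\}=\mathbb{Z}_m^*$, and $\bar T'=\{(-r_j,-t_j)\}_{j=1}^p$. A product $W_{ST}$ is the collection of unordered pairs $\{nr+x,\ nt+y\}$ (mod $nm$, with $x,y$ represented in $\{0,\dots,n-1\}$) of two types: (i) one pair for each $(r,t)\in\bar T\cup\bar T'\cup\{(0,0)\}$ and each $(x,y)\in\tilde S$; (ii) one pair for each $(r,t)\in\bar T$ with $x=y=0$. It is a 2-partition of $\mathbb{Z}_{nm}^*$. -}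

module Defs where

open import Data.Nat using (ℕ; zero; suc; _+_; _*_; _∸_; _<_)
open import Data.Nat.DivMod using (_%_)
open import Data.Product using (_×_; _,_; proj₁; proj₂; swap)
open import Data.Sum using (_⊎_)
open import Data.List using (List; []; _∷_; _++_; map; concatMap; upTo; drop)
open import Data.List.Membership.Propositional using (_∈_)
open import Data.List.Relation.Binary.Pointwise using (Pointwise)
open import Data.List.Relation.Binary.Permutation.Propositional using (_↭_)
open import Relation.Binary.PropositionalEquality using (_≡_)
open import Function.Bundles using (_⇔_)

-- Elements of ℤ_k are represented by naturals in {0,…,k-1}.
-- Reduction mod k (k = 0 never occurs in the theorem; defined for totality).
_mod_ : ℕ → ℕ → ℕ
x mod zero    = x
x mod (suc k) = x % suc k

neg : ℕ → ℕ → ℕ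
neg k x = (k ∸ (x mod k)) mod k

ZStar : ℕ → List ℕ
ZStar k = drop 1 (upTo k)

CoversStar : ℕ → List ℕ → Set
CoversStar k L = ∀ z → (z ∈ L) ⇔ (0 < z × z < k)

-- A (unordered) pair {x,y} is stored as an ordered pair (x , y);
-- all notions below are insensitive to the order within a pair.
Pairs : Set
Pairs = List (ℕ × ℕ)

flatten : Pairs → List ℕ
flatten = concatMap (λ p → proj₁ p ∷ proj₂ p ∷ [])

Is2Partition : ℕ → Pairs → Set
Is2Partition k P = flatten P ↭ ZStar k

plusMinusSums : ℕ → Pairs → List ℕ
plusMinusSums k P =
  map (λ p → (proj₁ p + proj₂ p) mod k) P ++ map (λ p → neg k (proj₁ p + proj₂ p)) P

Skew : ℕ → Pairs → Set
Skew k P = CoversStar k (plusMinusSums k P)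

IsOrderingOf : Pairs → Pairs → Set
IsOrderingOf P Q = Pointwise (λ a b → b ≡ a ⊎ b ≡ swap a) P Q

FirstCoordsCover : ℕ → Pairs → Set
FirstCoordsCover m Tb = CoversStar m (map proj₁ Tb ++ map (λ p → neg m (proj₁ p)) Tb)

negPairs : ℕ → Pairs → Pairs
negPairs m Tb = map (λ p → neg m (proj₁ p) , neg m (proj₂ p)) Tb

product : ℕ → ℕ → Pairs → Pairs → Pairs
product n m St Tb =
  concatMap (λ rt → map (λ xy → ((n * proj₁ rt + proj₁ xy) mod (n * m)
                                , (n * proj₂ rt + proj₂ xy) mod (n * m))) St)
            (Tb ++ negPairs m Tb ++ ((0 , 0) ∷ []))
  ++ map (λ rt → ((n * proj₁ rt) mod (n * m) , (n * proj₂ rt) mod (n * m))) Tb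

-- Skewness of a list of pairs splits into two properties of its pair sums: none is ≡ 0, and
-- together with their negatives they reach every nonzero residue.  Modulo N = nm a type (i)
-- pair has sum n(r+t) + (x+y) and a type (ii) pair has sum n(r+t).  Reducing mod n sees only
-- x+y, and dividing a type (ii) sum by n sees r+t mod m; this moves both properties between W
-- and S, T.  To reach a residue z mod N with n ∤ z, match z by ±(x+y) mod n and supply the
-- missing multiple of n by an offset (r,t) ∈ T̄ ∪ T̄′ ∪ {(0,0)}, whose sums r+t run through all
-- residues mod m because T is skew.  The one global step is that no x+y vanishes when W is
-- skew: W has (nm−1)/2 pairs, so its ±-sums are pairwise distinct, and the m−1 ±-sums of the
-- type (ii) pairs already exhaust the multiples of n in ℤ_N^*, leaving no room for the sum
-- x+y of the type (i) pair with offset (0,0).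

module Submission where

open import Defs
open import Data.Nat using (ℕ; _≤_; _*_)
open import Data.Nat.DivMod using (_%_)
open import Data.Product using (_×_)
open import Relation.Binary.PropositionalEquality using (_≡_)
open import Function.Bundles using (_⇔_)

open import Data.Empty using (⊥)
open import Data.Nat using (zero; suc; _+_; _∸_; _<_; z≤n; s≤s; NonZero; >-nonZero; >-nonZero⁻¹; _≟_)
open import Data.Nat.Properties
  using ( ≤-trans; ≤-reflexive; ≤-pred; <⇒≱; <-irrefl; n≢0⇒n>0; >⇒≢; m≤m*n; m≤n*m; m∸n+n≡m
        ; +-comm; +-assoc; +-identityʳ; *-comm; *-zeroʳ; *-suc; *-distribˡ-+; *-cancelˡ-≡; *-cancelˡ-<
        ; *-monoʳ-<; m*n≢0; +-commutativeSemigroup; module ≤-Reasoning )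
open import Algebra.Properties.CommutativeSemigroup +-commutativeSemigroup using (interchange)
open import Data.Nat.DivMod
  using ( %-distribˡ-+; m%n%n≡m%n; n%n≡0; m<n⇒m%n≡m; m%n≤n; m%n<n; m∣n⇒o%n%m≡o%m
        ; m%n*o≡m*o%[n*o]; %-congʳ )
open import Data.Nat.Divisibility using (_∣_; divides; m%n≡0⇒n∣m; n∣m⇒m%n≡0; m∣m*n)
open import Data.Nat.Tactic.RingSolver using (solve-∀)
open import Data.Product using (_,_; proj₁; proj₂; ∃)
import Data.Product as Product
open import Data.Sum using (_⊎_; inj₁; inj₂; [_,_])
import Data.Sum as Sum
open import Data.List using (List; []; _∷_; _++_; map; concatMap; length; upTo)
open import Data.List.Properties using (length-++; length-map; length-drop; length-upTo; map-++; ++-assoc)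
open import Data.List.Membership.Propositional using (_∈_; find; lose)
open import Data.List.Membership.Propositional.Properties
  using (∈-∃++; ∈-++⁻; ∈-++⁺ˡ; ∈-++⁺ʳ; ∈-map⁺; ∈-map⁻; ∈-applyUpTo⁺; ∈-applyUpTo⁻)
open import Data.List.Relation.Unary.Any using (Any; here; there)
import Data.List.Relation.Unary.Any as Any
open import Data.List.Relation.Unary.Any.Properties using (concatMap⁺; concatMap⁻; ++⁺ʳ; map⁻)
open import Data.List.Relation.Unary.All.Properties using (¬Any⇒All¬)
import Data.List.Relation.Unary.All.Properties as All
open import Data.List.Relation.Unary.Unique.Propositional using (Unique; []; _∷_)
open import Data.List.Relation.Unary.Unique.Propositional.Properties using (Unique[x∷xs]⇒x∉xs; drop⁺; upTo⁺)
open import Data.List.Relation.Binary.Pointwise using ([]; _∷_; Pointwise-length)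
open import Data.List.Relation.Binary.Subset.Propositional using (_⊆_)
open import Data.List.Relation.Binary.Permutation.Propositional
  using (_↭_; ↭-sym; ↭⇒↭ₛ; module PermutationReasoning)
open import Data.List.Relation.Binary.Permutation.Propositional.Properties
  using (shift; shifts; ++⁺ˡ; ∈-resp-↭; ↭-length)
import Data.List.Relation.Binary.Permutation.Setoid.Properties as Permutationₛ
open import Function.Base using (id)
open import Function.Bundles using (mk⇔; module Equivalence)
open Equivalence using (to; from)
open import Relation.Binary.Bundles using (Setoid)
open import Relation.Binary.Definitions using (DecidableEquality)
open import Relation.Binary.Structures using (IsEquivalence)
open import Relation.Binary.PropositionalEquality
  using (refl; sym; trans; cong; cong₂; subst; setoid; module ≡-Reasoning)
import Relation.Binary.Reasoning.Setoid as SetoidReasoning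
open import Relation.Nullary using (¬_; yes; no; contradiction)

-- Lists without repetitions

module _ {a} {A : Set a} where

  Unique-⊆⇒length-≤ : {xs ys : List A} → Unique xs → xs ⊆ ys → length xs ≤ length ys
  Unique-⊆⇒length-≤ [] _ = z≤n
  Unique-⊆⇒length-≤ {x ∷ xs} x∷xs!@(_ ∷ xs!) x∷xs⊆ys with ∈-∃++ (x∷xs⊆ys (here refl))
  ... | us , vs , refl =
    ≤-trans (s≤s (Unique-⊆⇒length-≤ xs! xs⊆us++vs)) (≤-reflexive (↭-length (↭-sym (shift x us vs))))
    where
    xs⊆us++vs : xs ⊆ us ++ vs
    xs⊆us++vs y∈xs with ∈-resp-↭ (shift x us vs) (x∷xs⊆ys (there y∈xs))
    ... | here refl      = contradiction y∈xs (Unique[x∷xs]⇒x∉xs x∷xs!)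
    ... | there y∈us++vs = y∈us++vs

  Unique-++⁻ʳ : ∀ xs {ys : List A} → Unique (xs ++ ys) → Unique ys
  Unique-++⁻ʳ []       ys!           = ys!
  Unique-++⁻ʳ (_ ∷ xs) (_ ∷ xs++ys!) = Unique-++⁻ʳ xs xs++ys!

  Unique-++⇒Unique-∷ : ∀ {x : A} xs {ys} → Unique (xs ++ ys) → x ∈ xs → Unique (x ∷ ys)
  Unique-++⇒Unique-∷ (_ ∷ xs) (x∉ ∷ xs++ys!) (here refl)  = All.++⁻ʳ xs x∉ ∷ Unique-++⁻ʳ xs xs++ys!
  Unique-++⇒Unique-∷ (_ ∷ xs) (_ ∷ xs++ys!)  (there x∈xs) = Unique-++⇒Unique-∷ xs xs++ys! x∈xs

  Unique-resp-↭ : {xs ys : List A} → xs ↭ ys → Unique xs → Unique ys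
  Unique-resp-↭ xs↭ys = Permutationₛ.Unique-resp-↭ (setoid A) (↭⇒↭ₛ xs↭ys)

  ⊆-∷⇒⊆ : {x : A} {xs ys : List A} → ys ⊆ x ∷ xs → (x ∈ ys → x ∈ xs) → ys ⊆ xs
  ⊆-∷⇒⊆ ys⊆x∷xs x∈ys⇒x∈xs y∈ys with ys⊆x∷xs y∈ys
  ... | here refl  = x∈ys⇒x∈xs y∈ys
  ... | there y∈xs = y∈xs

  module _ (_≟_ : DecidableEquality A) where
    open import Data.List.Membership.DecPropositional _≟_ using (_∈?_)

    ⊆-length-≤⇒Unique : {xs ys : List A} → Unique ys → ys ⊆ xs → length xs ≤ length ys → Unique xs
    ⊆-length-≤⇒Unique {[]} _ _ _ = []
    ⊆-length-≤⇒Unique {x ∷ xs} {ys} ys! ys⊆x∷xs |x∷xs|≤|ys| with x ∈? xs | x ∈? ys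
    ... | yes x∈xs | _ =
      contradiction (Unique-⊆⇒length-≤ ys! (⊆-∷⇒⊆ ys⊆x∷xs (λ _ → x∈xs))) (<⇒≱ |x∷xs|≤|ys|)
    ... | no _ | no x∉ys =
      contradiction (Unique-⊆⇒length-≤ ys! (⊆-∷⇒⊆ ys⊆x∷xs (λ x∈ys → contradiction x∈ys x∉ys)))
                    (<⇒≱ |x∷xs|≤|ys|)
    ... | no x∉xs | yes x∈ys with ∈-∃++ x∈ys
    ...   | us , vs , refl = ¬Any⇒All¬ xs x∉xs ∷ ⊆-length-≤⇒Unique us++vs! us++vs⊆xs |xs|≤|us++vs|
      where
      x∷us++vs! : Unique (x ∷ us ++ vs)
      x∷us++vs! = Unique-resp-↭ (shift x us vs) ys!
      us++vs! : Unique (us ++ vs)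
      us++vs! with _ ∷ us++vs! ← x∷us++vs! = us++vs!
      us++vs⊆xs : us ++ vs ⊆ xs
      us++vs⊆xs = ⊆-∷⇒⊆ (λ y∈ → ys⊆x∷xs (∈-resp-↭ (↭-sym (shift x us vs)) (there y∈)))
                        (λ x∈us++vs → contradiction x∈us++vs (Unique[x∷xs]⇒x∉xs x∷us++vs!))
      |xs|≤|us++vs| : length xs ≤ length (us ++ vs)
      |xs|≤|us++vs| = ≤-pred (≤-trans |x∷xs|≤|ys| (≤-reflexive (↭-length (shift x us vs))))

length-concatMap : ∀ {a b} {A : Set a} {B : Set b} (f : A → List B) {c} xs →
                   (∀ x → length (f x) ≡ c) → length (concatMap f xs) ≡ length xs * c
length-concatMap f []       _     = refl
length-concatMap f (x ∷ xs) |f|≡c = trans (length-++ (f x)) (cong₂ _+_ (|f|≡c x) (length-concatMap f xs |f|≡c))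

-- Congruences

-- A record rather than an abbreviation for x % k ≡ y % k, so that x and y can be inferred.
infix 4 _≡_mod[_]
record _≡_mod[_] (x y k : ℕ) .{{_ : NonZero k}} : Set where
  constructor ≡-mod
  field %-≡ : x % k ≡ y % k

mod≡% : ∀ k .{{_ : NonZero k}} x → x mod k ≡ x % k
mod≡% (suc _) x = refl

neg≡ : ∀ k .{{_ : NonZero k}} x → neg k x ≡ (k ∸ x % k) % k
neg≡ (suc _) x = refl

module _ {k : ℕ} .{{_ : NonZero k}} where

  ≡mod-isEquivalence : IsEquivalence (λ x y → x ≡ y mod[ k ])
  ≡mod-isEquivalence = record
    { refl  = ≡-mod refl
    ; sym   = λ (≡-mod p) → ≡-mod (sym p)
    ; trans = λ (≡-mod p) (≡-mod q) → ≡-mod (trans p q)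
    }

  ≡mod-setoid : Setoid _ _
  ≡mod-setoid = record { isEquivalence = ≡mod-isEquivalence }

  open IsEquivalence ≡mod-isEquivalence public
    using () renaming (refl to ≡mod-refl; sym to ≡mod-sym; trans to ≡mod-trans; reflexive to ≡⇒≡mod)

  %≡0⇒≡0mod : ∀ {x} → x % k ≡ 0 → x ≡ 0 mod[ k ]
  %≡0⇒≡0mod p = ≡-mod (trans p (sym (m<n⇒m%n≡m (>-nonZero⁻¹ k))))

  ≡0mod⇒%≡0 : ∀ {x} → x ≡ 0 mod[ k ] → x % k ≡ 0
  ≡0mod⇒%≡0 (≡-mod p) = trans p (m<n⇒m%n≡m (>-nonZero⁻¹ k))

  %-≡mod : ∀ x → x % k ≡ x mod[ k ]
  %-≡mod x = ≡-mod (m%n%n≡m%n x k)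

  mod-≡mod : ∀ x → x mod k ≡ x mod[ k ]
  mod-≡mod x = ≡mod-trans (≡⇒≡mod (mod≡% k x)) (%-≡mod x)

  ≡mod⇒≡ : ∀ {x y} → x < k → y < k → x ≡ y mod[ k ] → x ≡ y
  ≡mod⇒≡ x<k y<k (≡-mod p) = trans (sym (m<n⇒m%n≡m x<k)) (trans p (m<n⇒m%n≡m y<k))

  +-cong : ∀ {x x′ y y′} → x ≡ x′ mod[ k ] → y ≡ y′ mod[ k ] → x + y ≡ x′ + y′ mod[ k ]
  +-cong {x} {x′} {y} {y′} (≡-mod p) (≡-mod q) = ≡-mod (begin
    (x + y) % k              ≡⟨ %-distribˡ-+ x y k ⟩
    (x % k + y % k) % k      ≡⟨ cong₂ (λ a b → (a + b) % k) p q ⟩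
    (x′ % k + y′ % k) % k    ≡⟨ %-distribˡ-+ x′ y′ k ⟨
    (x′ + y′) % k            ∎)
    where open ≡-Reasoning

  neg-inverseˡ : ∀ x → neg k x + x ≡ 0 mod[ k ]
  neg-inverseˡ x = begin
    neg k x + x              ≡⟨ cong (_+ x) (neg≡ k x) ⟩
    (k ∸ x % k) % k + x      ≈⟨ +-cong (%-≡mod _) (≡mod-sym (%-≡mod x)) ⟩
    (k ∸ x % k) + x % k      ≡⟨ m∸n+n≡m (m%n≤n x k) ⟩
    k                        ≈⟨ %≡0⇒≡0mod (n%n≡0 k) ⟩
    0                        ∎
    where open SetoidReasoning ≡mod-setoid

  neg-inverseʳ : ∀ x → x + neg k x ≡ 0 mod[ k ]
  neg-inverseʳ x = ≡mod-trans (≡⇒≡mod (+-comm x (neg k x))) (neg-inverseˡ x)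

  +-cancelʳ : ∀ z {x y} → x + z ≡ y + z mod[ k ] → x ≡ y mod[ k ]
  +-cancelʳ z {x} {y} p = begin
    x                    ≡⟨ +-identityʳ x ⟨
    x + 0                ≈⟨ +-cong ≡mod-refl (neg-inverseʳ z) ⟨
    x + (z + neg k z)    ≡⟨ +-assoc x z (neg k z) ⟨
    x + z + neg k z      ≈⟨ +-cong p ≡mod-refl ⟩
    y + z + neg k z      ≡⟨ +-assoc y z (neg k z) ⟩
    y + (z + neg k z)    ≈⟨ +-cong ≡mod-refl (neg-inverseʳ z) ⟩
    y + 0                ≡⟨ +-identityʳ y ⟩
    y                    ∎
    where open SetoidReasoning ≡mod-setoid

≡mod-∣ : ∀ {d k x y} .{{_ : NonZero d}} .{{_ : NonZero k}} → d ∣ k → x ≡ y mod[ k ] → x ≡ y mod[ d ]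
≡mod-∣ {d} {k} {x} {y} d∣k (≡-mod p) = ≡-mod (begin
  x % d       ≡⟨ m∣n⇒o%n%m≡o%m d k x d∣k ⟨
  x % k % d   ≡⟨ cong (_% d) p ⟩
  y % k % d   ≡⟨ m∣n⇒o%n%m≡o%m d k y d∣k ⟩
  y % d       ∎)
  where open ≡-Reasoning

infix 4 _≡±_mod[_]
_≡±_mod[_] : ℕ → ℕ → (k : ℕ) .{{_ : NonZero k}} → Set
z ≡± s mod[ k ] = z ≡ s mod[ k ] ⊎ z + s ≡ 0 mod[ k ]

module _ {k : ℕ} .{{_ : NonZero k}} where

  ≡±-resp : ∀ {z z′ s s′} → z ≡ z′ mod[ k ] → s ≡ s′ mod[ k ] →
            z ≡± s mod[ k ] → z′ ≡± s′ mod[ k ]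
  ≡±-resp z≡z′ s≡s′ (inj₁ z≡s)   = inj₁ (≡mod-trans (≡mod-sym z≡z′) (≡mod-trans z≡s s≡s′))
  ≡±-resp z≡z′ s≡s′ (inj₂ z+s≡0) =
    inj₂ (≡mod-trans (+-cong (≡mod-sym z≡z′) (≡mod-sym s≡s′)) z+s≡0)

  0≡±⇔≡0 : ∀ {s} → 0 ≡± s mod[ k ] ⇔ s ≡ 0 mod[ k ]
  0≡±⇔≡0 = mk⇔ [ ≡mod-sym , id ] inj₂

  ≡±0⇒≡0 : ∀ {z} → z ≡± 0 mod[ k ] → z ≡ 0 mod[ k ]
  ≡±0⇒≡0     (inj₁ z≡0)   = z≡0
  ≡±0⇒≡0 {z} (inj₂ z+0≡0) = ≡mod-trans (≡⇒≡mod (sym (+-identityʳ z))) z+0≡0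

≡±-∣ : ∀ {d k z s} .{{_ : NonZero d}} .{{_ : NonZero k}} → d ∣ k → z ≡± s mod[ k ] → z ≡± s mod[ d ]
≡±-∣ d∣k = Sum.map (≡mod-∣ d∣k) (≡mod-∣ d∣k)

module _ {n m : ℕ} .{{_ : NonZero n}} .{{_ : NonZero m}} where
  private
    N : ℕ
    N = n * m
    instance
      N≢0 : NonZero N
      N≢0 = m*n≢0 n m
      m*n≢0′ : NonZero (m * n)
      m*n≢0′ = m*n≢0 m n
    n∣N : n ∣ N
    n∣N = m∣m*n m

  [n*x]%[n*m]≡n*[x%m] : ∀ x → (n * x) % N ≡ n * (x % m)
  [n*x]%[n*m]≡n*[x%m] x = begin
    (n * x) % (n * m)   ≡⟨ cong (_% N) (*-comm n x) ⟩
    (x * n) % (n * m)   ≡⟨ %-congʳ (*-comm n m) ⟩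
    (x * n) % (m * n)   ≡⟨ m%n*o≡m*o%[n*o] x m n ⟨
    x % m * n           ≡⟨ *-comm (x % m) n ⟩
    n * (x % m)         ∎
    where open ≡-Reasoning

  *-cancel-≡mod : ∀ {x y} → n * x ≡ n * y mod[ N ] ⇔ x ≡ y mod[ m ]
  *-cancel-≡mod {x} {y} = mk⇔
    (λ (≡-mod p) → ≡-mod (*-cancelˡ-≡ _ _ n (trans (sym (scale x)) (trans p (scale y)))))
    (λ (≡-mod p) → ≡-mod (trans (scale x) (trans (cong (n *_) p) (sym (scale y)))))
    where
    scale : ∀ x → (n * x) % N ≡ n * (x % m)
    scale = [n*x]%[n*m]≡n*[x%m]

  *-cancel-≡± : ∀ {z s} → n * z ≡± n * s mod[ N ] ⇔ z ≡± s mod[ m ]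
  *-cancel-≡± {z} {s} = mk⇔
    (Sum.map cancel (λ p → cancel (resp (sym (*-distribˡ-+ n z s)) (sym (*-zeroʳ n)) p)))
    (Sum.map uncancel (λ p → resp (*-distribˡ-+ n z s) (*-zeroʳ n) (uncancel p)))
    where
    cancel : ∀ {x y} → n * x ≡ n * y mod[ N ] → x ≡ y mod[ m ]
    cancel = to *-cancel-≡mod
    uncancel : ∀ {x y} → x ≡ y mod[ m ] → n * x ≡ n * y mod[ N ]
    uncancel = from *-cancel-≡mod
    resp : ∀ {x x′ y y′} → x ≡ x′ → y ≡ y′ → x ≡ y mod[ N ] → x′ ≡ y′ mod[ N ]
    resp refl refl p = p

  *-≡0mod : ∀ x → n * x ≡ 0 mod[ n ]
  *-≡0mod x = %≡0⇒≡0mod (n∣m⇒m%n≡0 (n * x) n (m∣m*n x))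

  ≡0mod⇒≡n*u : ∀ {x} → x ≡ 0 mod[ n ] → x < N → ∃ λ u → u < m × x ≡ n * u
  ≡0mod⇒≡n*u {x} x≡0 x<N with divides u refl ← m%n≡0⇒n∣m x n (≡0mod⇒%≡0 x≡0) =
    u , *-cancelˡ-< n u m (subst (_< N) (*-comm u n) x<N) , *-comm u n

  lift-≡mod : ∀ {x s} → x ≡ s mod[ n ] → ∃ λ u → x ≡ n * u + s mod[ N ]
  lift-≡mod {x} {s} x≡s = lift (≡0mod⇒≡n*u w≡0 (m%n<n (x + neg N s) N))
    where
    open SetoidReasoning (≡mod-setoid {N})
    w : ℕ
    w = (x + neg N s) % N
    w≡0 : w ≡ 0 mod[ n ]
    w≡0 = ≡mod-trans (≡mod-∣ n∣N (%-≡mod {N} _))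
                     (≡mod-trans (+-cong x≡s ≡mod-refl) (≡mod-∣ n∣N (neg-inverseʳ {N} s)))
    lift : (∃ λ u → u < m × w ≡ n * u) → ∃ λ u → x ≡ n * u + s mod[ N ]
    lift (u , _ , w≡n*u) = u , (begin
      x                    ≡⟨ +-identityʳ x ⟨
      x + 0                ≈⟨ +-cong ≡mod-refl (neg-inverseˡ s) ⟨
      x + (neg N s + s)    ≡⟨ +-assoc x _ s ⟨
      x + neg N s + s      ≈⟨ +-cong (%-≡mod _) ≡mod-refl ⟨
      w + s                ≡⟨ cong (_+ s) w≡n*u ⟩
      n * u + s            ∎)

  lift-≡± : ∀ {z s} → z ≡± s mod[ n ] → ∃ λ u → z ≡± n * u + s mod[ N ]
  lift-≡± (inj₁ z≡s) = Product.map₂ inj₁ (lift-≡mod z≡s)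
  lift-≡± {z} {s} (inj₂ z+s≡0) = Product.map₂ (λ -z≡v → inj₂ (negate -z≡v)) (lift-≡mod -z≡s)
    where
    open SetoidReasoning (≡mod-setoid {N})
    -z≡s : neg N z ≡ s mod[ n ]
    -z≡s = +-cancelʳ z (≡mod-trans (≡mod-∣ n∣N (neg-inverseˡ {N} z))
                                   (≡mod-trans (≡mod-sym z+s≡0) (≡⇒≡mod (+-comm z s))))
    negate : ∀ {v} → neg N z ≡ v mod[ N ] → z + v ≡ 0 mod[ N ]
    negate {v} -z≡v = begin
      z + v                ≈⟨ +-cong ≡mod-refl -z≡v ⟨
      z + neg N z          ≈⟨ neg-inverseʳ z ⟩
      0                    ∎

-- Pair sums

pairSum : ℕ × ℕ → ℕ
pairSum p = proj₁ p + proj₂ p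

SumsNonzero : (k : ℕ) .{{_ : NonZero k}} → Pairs → Set
SumsNonzero k P = ¬ Any (λ p → pairSum p ≡ 0 mod[ k ]) P

SumsCover : (k : ℕ) .{{_ : NonZero k}} → Pairs → Set
SumsCover k P = ∀ {z} → 0 < z → z < k → Any (λ p → z ≡± pairSum p mod[ k ]) P

module _ {k : ℕ} .{{_ : NonZero k}} where

  mod-< : ∀ x → x mod k < k
  mod-< x = subst (_< k) (sym (mod≡% k x)) (m%n<n x k)

  neg-< : ∀ x → neg k x < k
  neg-< x = subst (_< k) (sym (neg≡ k x)) (m%n<n _ k)

  ∈-plusMinusSums⇒< : ∀ {z P} → z ∈ plusMinusSums k P → z < k
  ∈-plusMinusSums⇒< {P = P} z∈ with ∈-++⁻ (map (λ p → pairSum p mod k) P) z∈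
  ... | inj₁ z∈sums with _ , _ , refl ← ∈-map⁻ _ z∈sums = mod-< _
  ... | inj₂ z∈negs with _ , _ , refl ← ∈-map⁻ _ z∈negs = neg-< _

  ∈-plusMinusSums⇔ : ∀ {z P} → z < k → z ∈ plusMinusSums k P ⇔ Any (λ p → z ≡± pairSum p mod[ k ]) P
  ∈-plusMinusSums⇔ {z} {P} z<k = mk⇔ ∈⇒Any Any⇒∈
    where
    ∈⇒Any : z ∈ plusMinusSums k P → Any (λ p → z ≡± pairSum p mod[ k ]) P
    ∈⇒Any z∈ with ∈-++⁻ (map (λ p → pairSum p mod k) P) z∈
    ... | inj₁ z∈sums with p , p∈P , refl ← ∈-map⁻ _ z∈sums = lose p∈P (inj₁ (mod-≡mod (pairSum p)))
    ... | inj₂ z∈negs with p , p∈P , refl ← ∈-map⁻ _ z∈negs = lose p∈P (inj₂ (neg-inverseˡ (pairSum p)))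
    ≡±⇒∈ : ∀ {p} → p ∈ P → z ≡± pairSum p mod[ k ] → z ∈ plusMinusSums k P
    ≡±⇒∈ p∈P (inj₁ z≡s) =
      ∈-++⁺ˡ (subst (_∈ _) (sym (≡mod⇒≡ z<k (mod-< _) (≡mod-trans z≡s (≡mod-sym (mod-≡mod _)))))
                           (∈-map⁺ (λ p → pairSum p mod k) p∈P))
    ≡±⇒∈ {p} p∈P (inj₂ z+s≡0) =
      ∈-++⁺ʳ _ (subst (_∈ _) (sym (≡mod⇒≡ z<k (neg-< _) (+-cancelʳ (pairSum p) z+s≡-s+s)))
                             (∈-map⁺ (λ p → neg k (pairSum p)) p∈P))
      where
      z+s≡-s+s : z + pairSum p ≡ neg k (pairSum p) + pairSum p mod[ k ]
      z+s≡-s+s = ≡mod-trans z+s≡0 (≡mod-sym (neg-inverseˡ _))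
    Any⇒∈ : Any (λ p → z ≡± pairSum p mod[ k ]) P → z ∈ plusMinusSums k P
    Any⇒∈ any = let _ , p∈P , z≡±s = find any in ≡±⇒∈ p∈P z≡±s

  Skew⇔SumsNonzero×SumsCover : ∀ {P} → Skew k P ⇔ (SumsNonzero k P × SumsCover k P)
  Skew⇔SumsNonzero×SumsCover {P} = mk⇔ split combine
    where
    split : Skew k P → SumsNonzero k P × SumsCover k P
    split skew = nonzero , cover
      where
      nonzero : SumsNonzero k P
      nonzero s≡0 = <-irrefl refl (proj₁ (to (skew 0)
        (from (∈-plusMinusSums⇔ {P = P} (>-nonZero⁻¹ k)) (Any.map (from 0≡±⇔≡0) s≡0))))
      cover : SumsCover k P
      cover 0<z z<k = to (∈-plusMinusSums⇔ {P = P} z<k) (from (skew _) (0<z , z<k))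
    combine : SumsNonzero k P × SumsCover k P → Skew k P
    combine (nonzero , cover) z = mk⇔
      (λ z∈ → let z<k = ∈-plusMinusSums⇒< {P = P} z∈ in positive z<k z∈ , z<k)
      (λ (0<z , z<k) → from (∈-plusMinusSums⇔ {P = P} z<k) (cover 0<z z<k))
      where
      positive : z < k → z ∈ plusMinusSums k P → 0 < z
      positive z<k z∈ = n≢0⇒n>0 λ { refl →
        nonzero (Any.map (to 0≡±⇔≡0) (to (∈-plusMinusSums⇔ {P = P} z<k) z∈)) }

IsOrderingOf⇒map-pairSum≡ : ∀ (g : ℕ → ℕ) {P Q} → IsOrderingOf P Q →
                            map (λ p → g (pairSum p)) P ≡ map (λ p → g (pairSum p)) Q
IsOrderingOf⇒map-pairSum≡ g [] = refl
IsOrderingOf⇒map-pairSum≡ g (inj₁ refl ∷ P~Q) = cong (_ ∷_) (IsOrderingOf⇒map-pairSum≡ g P~Q)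
IsOrderingOf⇒map-pairSum≡ g {(x , y) ∷ _} (inj₂ refl ∷ P~Q) =
  cong₂ _∷_ (cong g (+-comm x y)) (IsOrderingOf⇒map-pairSum≡ g P~Q)

IsOrderingOf⇒plusMinusSums≡ : ∀ k {P Q} → IsOrderingOf P Q → plusMinusSums k P ≡ plusMinusSums k Q
IsOrderingOf⇒plusMinusSums≡ k P~Q =
  cong₂ _++_ (IsOrderingOf⇒map-pairSum≡ (_mod k) P~Q) (IsOrderingOf⇒map-pairSum≡ (neg k) P~Q)

Skew-resp-IsOrderingOf : ∀ k {P Q} → IsOrderingOf P Q → Skew k P ≡ Skew k Q
Skew-resp-IsOrderingOf k P~Q = cong (CoversStar k) (IsOrderingOf⇒plusMinusSums≡ k P~Q)

plusMinusSums-++ : ∀ k P Q → plusMinusSums k (P ++ Q) ↭ plusMinusSums k P ++ plusMinusSums k Q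
plusMinusSums-++ k P Q = begin
  map f (P ++ Q) ++ map g (P ++ Q)            ≡⟨ cong₂ _++_ (map-++ f P Q) (map-++ g P Q) ⟩
  (map f P ++ map f Q) ++ map g P ++ map g Q  ≡⟨ ++-assoc (map f P) (map f Q) _ ⟩
  map f P ++ map f Q ++ map g P ++ map g Q    ↭⟨ ++⁺ˡ (map f P) (shifts (map f Q) (map g P)) ⟩
  map f P ++ map g P ++ map f Q ++ map g Q    ≡⟨ ++-assoc (map f P) (map g P) _ ⟨
  (map f P ++ map g P) ++ map f Q ++ map g Q  ∎
  where
  open PermutationReasoning
  f g : ℕ × ℕ → ℕ
  f p = pairSum p mod k
  g p = neg k (pairSum p)

length-plusMinusSums : ∀ k P → length (plusMinusSums k P) ≡ 2 * length P
length-plusMinusSums k P = begin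
  length (map _ P ++ map _ P)          ≡⟨ length-++ (map _ P) ⟩
  length (map _ P) + length (map _ P)  ≡⟨ cong₂ _+_ (length-map _ P) (length-map _ P) ⟩
  length P + length P                  ≡⟨ cong (length P +_) (+-identityʳ (length P)) ⟨
  2 * length P                         ∎
  where open ≡-Reasoning

-- ℤ_k^* and 2-partitions

ZStar-covers : ∀ k → CoversStar k (ZStar k)
ZStar-covers zero    z = mk⇔ (λ ()) λ { (_ , ()) }
ZStar-covers (suc k) z = mk⇔ bounds member
  where
  bounds : z ∈ ZStar (suc k) → 0 < z × z < suc k
  bounds z∈ with i , i<k , refl ← ∈-applyUpTo⁻ suc z∈ = s≤s z≤n , s≤s i<k
  member : 0 < z × z < suc k → z ∈ ZStar (suc k)
  member (s≤s _ , s≤s z<k) = ∈-applyUpTo⁺ suc z<k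

ZStar-unique : ∀ k → Unique (ZStar k)
ZStar-unique k = drop⁺ 1 (upTo⁺ k)

length-ZStar : ∀ k → length (ZStar k) ≡ k ∸ 1
length-ZStar k = trans (length-drop 1 (upTo k)) (cong (_∸ 1) (length-upTo k))

length-flatten : ∀ P → length (flatten P) ≡ 2 * length P
length-flatten []      = refl
length-flatten (_ ∷ P) = trans (cong (2 +_) (length-flatten P)) (sym (*-suc 2 (length P)))

Is2Partition⇒length : ∀ k .{{_ : NonZero k}} {P} → Is2Partition k P → suc (2 * length P) ≡ k
Is2Partition⇒length (suc k) {P} P-part = cong suc (begin
  2 * length P            ≡⟨ length-flatten P ⟨
  length (flatten P)      ≡⟨ ↭-length P-part ⟩
  length (ZStar (suc k))  ≡⟨ length-ZStar (suc k) ⟩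
  k                       ∎)
  where open ≡-Reasoning

Is2Partition∧IsOrderingOf⇒length : ∀ k .{{_ : NonZero k}} {P Q} →
                                   Is2Partition k P → IsOrderingOf P Q → suc (2 * length Q) ≡ k
Is2Partition∧IsOrderingOf⇒length k {P} P-part P~Q =
  trans (cong (λ l → suc (2 * l)) (sym (Pointwise-length P~Q))) (Is2Partition⇒length k {P} P-part)

Skew⇒Unique : ∀ k {P} → 2 * length P ≤ k ∸ 1 → Skew k P → Unique (plusMinusSums k P)
Skew⇒Unique k {P} |P|≤ skew = ⊆-length-≤⇒Unique _≟_ (ZStar-unique k)
  (λ {z} z∈ → from (skew z) (to (ZStar-covers k z) z∈))
  (subst (_≤ length (ZStar k)) (sym (length-plusMinusSums k P)) (subst (2 * length P ≤_) (sym (length-ZStar k)) |P|≤))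

-- The product

module ProductOf (n m : ℕ) .{{_ : NonZero n}} .{{_ : NonZero m}} (St Tb : Pairs) where

  N : ℕ
  N = n * m

  instance
    N≢0 : NonZero N
    N≢0 = m*n≢0 n m

  n∣N : n ∣ N
  n∣N = m∣m*n m

  Offsets : Pairs
  Offsets = Tb ++ negPairs m Tb ++ (0 , 0) ∷ []

  lifted : ℕ × ℕ → ℕ × ℕ → ℕ × ℕ
  lifted rt xy = ((n * proj₁ rt + proj₁ xy) mod N , (n * proj₂ rt + proj₂ xy) mod N)

  scaled : ℕ × ℕ → ℕ × ℕ
  scaled rt = ((n * proj₁ rt) mod N , (n * proj₂ rt) mod N)

  TypeI TypeII W : Pairs
  TypeI  = concatMap (λ rt → map (lifted rt) St) Offsets
  TypeII = map scaled Tb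
  W      = product n m St Tb

  data Origin : ℕ × ℕ → Set where
    typeI  : ∀ {rt xy} → rt ∈ Offsets → xy ∈ St → Origin (lifted rt xy)
    typeII : ∀ {rt} → rt ∈ Tb → Origin (scaled rt)

  origin : ∀ {p} → p ∈ W → Origin p
  origin p∈W with ∈-++⁻ TypeI p∈W
  ... | inj₁ p∈I = typeI-origin (find (concatMap⁻ (λ rt → map (lifted rt) St) p∈I))
    where
    typeI-origin : ∀ {p} → (∃ λ rt → rt ∈ Offsets × p ∈ map (lifted rt) St) → Origin p
    typeI-origin (rt , rt∈ , p∈row) with xy , xy∈ , refl ← ∈-map⁻ (lifted rt) p∈row = typeI rt∈ xy∈
  ... | inj₂ p∈II with rt , rt∈ , refl ← ∈-map⁻ scaled p∈II = typeII rt∈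

  lifted-∈-TypeI : ∀ {rt xy} → rt ∈ Offsets → xy ∈ St → lifted rt xy ∈ TypeI
  lifted-∈-TypeI {rt} rt∈ xy∈ = concatMap⁺ (λ rt → map (lifted rt) St) (lose rt∈ (∈-map⁺ (lifted rt) xy∈))

  lifted-∈ : ∀ {rt xy} → rt ∈ Offsets → xy ∈ St → lifted rt xy ∈ W
  lifted-∈ rt∈ xy∈ = ∈-++⁺ˡ (lifted-∈-TypeI rt∈ xy∈)

  scaled-∈ : ∀ {rt} → rt ∈ Tb → scaled rt ∈ W
  scaled-∈ rt∈ = ∈-++⁺ʳ TypeI (∈-map⁺ scaled rt∈)

  length-W : length W ≡ (length Tb + (length Tb + 1)) * length St + length Tb
  length-W = begin
    length (TypeI ++ TypeII)                               ≡⟨ length-++ TypeI ⟩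
    length TypeI + length TypeII                           ≡⟨ cong₂ _+_ |TypeI| (length-map scaled Tb) ⟩
    length Offsets * length St + length Tb                 ≡⟨ cong (λ l → l * length St + length Tb) |Offsets| ⟩
    (length Tb + (length Tb + 1)) * length St + length Tb  ∎
    where
    open ≡-Reasoning
    |TypeI| : length TypeI ≡ length Offsets * length St
    |TypeI| = length-concatMap (λ rt → map (lifted rt) St) Offsets (λ rt → length-map (lifted rt) St)
    |Offsets| : length Offsets ≡ length Tb + (length Tb + 1)
    |Offsets| = trans (length-++ Tb)
      (cong (length Tb +_) (trans (length-++ (negPairs m Tb)) (cong (_+ 1) (length-map _ Tb))))

  2*length-W : suc (2 * length St) ≡ n → suc (2 * length Tb) ≡ m → 2 * length W ≡ N ∸ 1
  2*length-W |St| |Tb| = begin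
    2 * length W                   ≡⟨ cong (2 *_) length-W ⟩
    2 * ((t + (t + 1)) * s + t)    ≡⟨ arith s t ⟩
    suc (2 * s) * suc (2 * t) ∸ 1  ≡⟨ cong₂ (λ a b → a * b ∸ 1) |St| |Tb| ⟩
    N ∸ 1                          ∎
    where
    open ≡-Reasoning
    s t : ℕ
    s = length St
    t = length Tb
    arith : ∀ s t → 2 * ((t + (t + 1)) * s + t) ≡ 2 * t + 2 * s * suc (2 * t)
    arith = solve-∀

  pairSum-lifted : ∀ rt xy → pairSum (lifted rt xy) ≡ n * pairSum rt + pairSum xy mod[ N ]
  pairSum-lifted (r , t) (x , y) = begin
    (n * r + x) mod N + (n * t + y) mod N  ≈⟨ +-cong (mod-≡mod _) (mod-≡mod _) ⟩
    (n * r + x) + (n * t + y)              ≡⟨ interchange (n * r) x (n * t) y ⟩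
    (n * r + n * t) + (x + y)              ≡⟨ cong (_+ (x + y)) (*-distribˡ-+ n r t) ⟨
    n * (r + t) + (x + y)                  ∎
    where open SetoidReasoning (≡mod-setoid {N})

  pairSum-scaled : ∀ rt → pairSum (scaled rt) ≡ n * pairSum rt mod[ N ]
  pairSum-scaled (r , t) = ≡mod-trans (+-cong (mod-≡mod _) (mod-≡mod _)) (≡⇒≡mod (sym (*-distribˡ-+ n r t)))

  lifted≡±⇒ : ∀ {z} rt xy → z ≡± pairSum (lifted rt xy) mod[ N ] → z ≡± pairSum xy mod[ n ]
  lifted≡±⇒ rt xy z≡±p = ≡±-resp ≡mod-refl (+-cong (*-≡0mod {n} {m} (pairSum rt)) ≡mod-refl)
                                 (≡±-∣ n∣N (≡±-resp ≡mod-refl (pairSum-lifted rt xy) z≡±p))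

  scaled≡±⇒ : ∀ {z} rt → z ≡± pairSum (scaled rt) mod[ N ] → z ≡ 0 mod[ n ]
  scaled≡±⇒ rt z≡±p = ≡±0⇒≡0 (≡±-resp ≡mod-refl (*-≡0mod {n} {m} (pairSum rt))
                                      (≡±-∣ n∣N (≡±-resp ≡mod-refl (pairSum-scaled rt) z≡±p)))

  scaled≡±⇔ : ∀ {z} rt → n * z ≡± pairSum (scaled rt) mod[ N ] ⇔ z ≡± pairSum rt mod[ m ]
  scaled≡±⇔ rt = mk⇔
    (λ h → to *-cancel-≡± (≡±-resp ≡mod-refl (pairSum-scaled rt) h))
    (λ h → ≡±-resp ≡mod-refl (≡mod-sym (pairSum-scaled rt)) (from *-cancel-≡± h))

  Offsets-cover : SumsCover m Tb → ∀ u → Any (λ rt → pairSum rt ≡ u mod[ m ]) Offsets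
  Offsets-cover cover u with u % m ≟ 0
  ... | yes u%m≡0 = ++⁺ʳ Tb (++⁺ʳ (negPairs m Tb) (here (≡mod-sym (%≡0⇒≡0mod u%m≡0))))
  ... | no u%m≢0 = let _ , rt∈ , h = find (cover (n≢0⇒n>0 u%m≢0) (m%n<n u m)) in
                   from-Tb rt∈ (≡±-resp (%-≡mod u) ≡mod-refl h)
    where
    from-Tb : ∀ {rt} → rt ∈ Tb → u ≡± pairSum rt mod[ m ] → Any (λ rt → pairSum rt ≡ u mod[ m ]) Offsets
    from-Tb rt∈ (inj₁ u≡s) = lose (∈-++⁺ˡ rt∈) (≡mod-sym u≡s)
    from-Tb {r , t} rt∈ (inj₂ u+s≡0) =
      lose (∈-++⁺ʳ Tb (∈-++⁺ˡ (∈-map⁺ (λ p → neg m (proj₁ p) , neg m (proj₂ p)) rt∈)))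
           (+-cancelʳ (r + t) (≡mod-trans -r-t+[r+t]≡0 (≡mod-sym u+s≡0)))
      where
      -r-t+[r+t]≡0 : neg m r + neg m t + (r + t) ≡ 0 mod[ m ]
      -r-t+[r+t]≡0 = ≡mod-trans (≡⇒≡mod (interchange (neg m r) (neg m t) r t))
                                (+-cong (neg-inverseˡ r) (neg-inverseˡ t))

  cover-St : SumsCover N W → SumsCover n St
  cover-St coverW {z} 0<z z<n =
    let _ , p∈W , h = find (coverW 0<z (≤-trans z<n (m≤m*n n m))) in project (origin p∈W) h
    where
    project : ∀ {p} → Origin p → z ≡± pairSum p mod[ N ] → Any (λ xy → z ≡± pairSum xy mod[ n ]) St
    project (typeI {rt} {xy} _ xy∈) h = lose xy∈ (lifted≡±⇒ rt xy h)
    project (typeII {rt} _)         h =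
      contradiction (≡mod⇒≡ z<n (>-nonZero⁻¹ n) (scaled≡±⇒ rt h)) (>⇒≢ 0<z)

  nonzero-Tb : SumsNonzero N W → SumsNonzero m Tb
  nonzero-Tb nonzeroW s≡0 = let rt , rt∈ , h = find s≡0 in
    nonzeroW (lose (scaled-∈ rt∈)
      (to 0≡±⇔≡0 (≡±-resp (≡⇒≡mod (*-zeroʳ n)) ≡mod-refl (from (scaled≡±⇔ rt) (from 0≡±⇔≡0 h)))))

  cover-Tb : SumsNonzero n St → SumsCover N W → SumsCover m Tb
  cover-Tb nonzeroS coverW {z} 0<z z<m =
    let _ , p∈W , h = find (coverW (≤-trans 0<z (m≤n*m z n)) (*-monoʳ-< n z<m)) in project (origin p∈W) h
    where
    project : ∀ {p} → Origin p → n * z ≡± pairSum p mod[ N ] → Any (λ rt → z ≡± pairSum rt mod[ m ]) Tb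
    project (typeI {rt} {xy} _ xy∈) h = contradiction
      (lose xy∈ (to 0≡±⇔≡0 (≡±-resp (*-≡0mod {n} {m} z) ≡mod-refl (lifted≡±⇒ rt xy h)))) nonzeroS
    project (typeII {rt} rt∈) h = lose rt∈ (to (scaled≡±⇔ rt) h)

  ∈-plusMinusSums-TypeII⇒≡0 : ∀ {b} → b ∈ plusMinusSums N TypeII → b ≡ 0 mod[ n ]
  ∈-plusMinusSums-TypeII⇒≡0 b∈ =
    let b<N = ∈-plusMinusSums⇒< {N} {P = TypeII} b∈
        rt , _ , h = find (map⁻ (to (∈-plusMinusSums⇔ {N} {P = TypeII} b<N) b∈))
    in scaled≡±⇒ rt h

  ∈-plusMinusSums-W⇒multiple : Skew N W → ∀ {b} → b ∈ plusMinusSums N W → b ≡ 0 mod[ n ] →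
                               b ∈ map (n *_) (ZStar m)
  ∈-plusMinusSums-W⇒multiple skewW {b} b∈ b≡0 =
    let 0<b , b<N = to (skewW b) b∈ in as-multiple 0<b (≡0mod⇒≡n*u {n} {m} b≡0 b<N)
    where
    as-multiple : 0 < b → (∃ λ u → u < m × b ≡ n * u) → b ∈ map (n *_) (ZStar m)
    as-multiple 0<b (u , u<m , refl) =
      ∈-map⁺ (n *_) (from (ZStar-covers m u) (n≢0⇒n>0 (λ { refl → >⇒≢ 0<b (*-zeroʳ n) }) , u<m))

  nonzero-St : suc (2 * length St) ≡ n → suc (2 * length Tb) ≡ m → Skew N W → SumsNonzero n St
  nonzero-St |St| |Tb| skewW s≡0 = let _ , xy∈ , h = find s≡0 in refute xy∈ h
    where
    M : List ℕ
    M = map (n *_) (ZStar m)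
    ±W↭ : plusMinusSums N W ↭ plusMinusSums N TypeI ++ plusMinusSums N TypeII
    ±W↭ = plusMinusSums-++ N TypeI TypeII
    ±W! : Unique (plusMinusSums N W)
    ±W! = Skew⇒Unique N {W} (≤-reflexive (2*length-W |St| |Tb|)) skewW
    |M|≡|±II| : length M ≡ length (plusMinusSums N TypeII)
    |M|≡|±II| = begin
      length M                         ≡⟨ length-map (n *_) (ZStar m) ⟩
      length (ZStar m)                 ≡⟨ length-ZStar m ⟩
      m ∸ 1                            ≡⟨ cong (_∸ 1) |Tb| ⟨
      2 * length Tb                    ≡⟨ cong (2 *_) (length-map scaled Tb) ⟨
      2 * length TypeII                ≡⟨ length-plusMinusSums N TypeII ⟨
      length (plusMinusSums N TypeII)  ∎
      where open ≡-Reasoning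
    refute : ∀ {xy} → xy ∈ St → pairSum xy ≡ 0 mod[ n ] → ⊥
    refute {xy} xy∈ s≡0 =
      <-irrefl refl (≤-trans (≤-reflexive (cong suc |M|≡|±II|)) (Unique-⊆⇒length-≤ B! B⊆M))
      where
      w : ℕ
      w = pairSum (lifted (0 , 0) xy) mod N
      w∈±I : w ∈ plusMinusSums N TypeI
      w∈±I = ∈-++⁺ˡ (∈-map⁺ (λ p → pairSum p mod N)
                             (lifted-∈-TypeI (∈-++⁺ʳ Tb (∈-++⁺ʳ (negPairs m Tb) (here refl))) xy∈))
      B : List ℕ
      B = w ∷ plusMinusSums N TypeII
      B! : Unique B
      B! = Unique-++⇒Unique-∷ (plusMinusSums N TypeI) (Unique-resp-↭ ±W↭ ±W!) w∈±I
      B⊆M : B ⊆ M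
      B⊆M (here refl) = ∈-plusMinusSums-W⇒multiple skewW (∈-resp-↭ (↭-sym ±W↭) (∈-++⁺ˡ w∈±I))
        (≡±0⇒≡0 (≡±-resp ≡mod-refl s≡0 (lifted≡±⇒ (0 , 0) xy (inj₁ (mod-≡mod _)))))
      B⊆M (there b∈) = ∈-plusMinusSums-W⇒multiple skewW
        (∈-resp-↭ (↭-sym ±W↭) (∈-++⁺ʳ (plusMinusSums N TypeI) b∈)) (∈-plusMinusSums-TypeII⇒≡0 b∈)

  nonzero-W : SumsNonzero n St → SumsNonzero m Tb → SumsNonzero N W
  nonzero-W nonzeroS nonzeroT s≡0 = let _ , p∈W , h = find s≡0 in refute (origin p∈W) (from 0≡±⇔≡0 h)
    where
    refute : ∀ {p} → Origin p → ¬ (0 ≡± pairSum p mod[ N ])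
    refute (typeI {rt} {xy} _ xy∈) h = nonzeroS (lose xy∈ (to 0≡±⇔≡0 (lifted≡±⇒ rt xy h)))
    refute (typeII {rt} rt∈) h = nonzeroT (lose rt∈
      (to 0≡±⇔≡0 (to (scaled≡±⇔ rt) (≡±-resp (≡⇒≡mod (sym (*-zeroʳ n))) ≡mod-refl h))))

  cover-W : SumsCover n St → SumsCover m Tb → SumsCover N W
  cover-W coverS coverT {z} 0<z z<N with z % n ≟ 0
  ... | yes z%n≡0 =
    let _ , u<m , z≡n*u = ≡0mod⇒≡n*u {n} {m} (%≡0⇒≡0mod z%n≡0) z<N in via-scaled u<m z≡n*u
    where
    via-scaled : ∀ {u} → u < m → z ≡ n * u → Any (λ p → z ≡± pairSum p mod[ N ]) W
    via-scaled {u} u<m refl =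
      let rt , rt∈ , h = find (coverT (n≢0⇒n>0 λ { refl → >⇒≢ 0<z (*-zeroʳ n) }) u<m) in
      lose (scaled-∈ rt∈) (from (scaled≡±⇔ rt) h)
  ... | no z%n≢0 = let _ , xy∈ , h = find (coverS (n≢0⇒n>0 z%n≢0) (m%n<n z n)) in
                   via-lifted xy∈ (lift-≡± {n} {m} (≡±-resp (%-≡mod z) ≡mod-refl h))
    where
    via-lifted : ∀ {xy} → xy ∈ St → (∃ λ u → z ≡± n * u + pairSum xy mod[ N ]) →
                 Any (λ p → z ≡± pairSum p mod[ N ]) W
    via-lifted {xy} xy∈ (u , h) =
      let rt , rt∈ , s≡u = find (Offsets-cover coverT u)
          n*u≡n*s : n * u ≡ n * pairSum rt mod[ N ]
          n*u≡n*s = from (*-cancel-≡mod {n} {m}) (≡mod-sym s≡u)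
      in lose (lifted-∈ rt∈ xy∈)
              (≡±-resp ≡mod-refl (≡mod-trans (+-cong n*u≡n*s ≡mod-refl) (≡mod-sym (pairSum-lifted rt xy))) h)

  Skew-product⇔ : suc (2 * length St) ≡ n → suc (2 * length Tb) ≡ m → Skew N W ⇔ (Skew n St × Skew m Tb)
  Skew-product⇔ |St| |Tb| = mk⇔ forward backward
    where
    forward : Skew N W → Skew n St × Skew m Tb
    forward skewW =
      let nonzeroW , coverW = to Skew⇔SumsNonzero×SumsCover skewW
          nonzeroS = nonzero-St |St| |Tb| skewW
      in from Skew⇔SumsNonzero×SumsCover (nonzeroS , cover-St coverW)
       , from Skew⇔SumsNonzero×SumsCover (nonzero-Tb nonzeroW , cover-Tb nonzeroS coverW)
    backward : Skew n St × Skew m Tb → Skew N W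
    backward (skewS , skewT) =
      let nonzeroS , coverS = to Skew⇔SumsNonzero×SumsCover skewS
          nonzeroT , coverT = to Skew⇔SumsNonzero×SumsCover skewT
      in from Skew⇔SumsNonzero×SumsCover (nonzero-W nonzeroS nonzeroT , cover-W coverS coverT)

theorem3p8 : (n m : ℕ) → 3 ≤ n → 3 ≤ m → n % 2 ≡ 1 → m % 2 ≡ 1 →
    (S T : Pairs) → Is2Partition n S → Is2Partition m T →
    (St Tb : Pairs) → IsOrderingOf S St → IsOrderingOf T Tb → FirstCoordsCover m Tb →
    Skew (n * m) (product n m St Tb) ⇔ (Skew n S × Skew m T)
theorem3p8 n m 3≤n 3≤m _ _ S T S-part T-part St Tb S~St T~Tb _ =
  subst (λ X → Skew (n * m) (product n m St Tb) ⇔ X)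
        (sym (cong₂ _×_ (Skew-resp-IsOrderingOf n S~St) (Skew-resp-IsOrderingOf m T~Tb)))
        (ProductOf.Skew-product⇔ n m St Tb
          (Is2Partition∧IsOrderingOf⇒length n S-part S~St)
          (Is2Partition∧IsOrderingOf⇒length m T-part T~Tb))
  where
  instance
    n≢0 : NonZero n
    n≢0 = >-nonZero (≤-trans (s≤s z≤n) 3≤n)
    m≢0 : NonZero m
    m≢0 = >-nonZero (≤-trans (s≤s z≤n) 3≤m)
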